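{- Let $\Sigma$ be a finite CW complex of dimension $d$ and suppose $\Sigma$ has a cellular spanning forest $\Upsilon$ such that $\tilde H_{d-1}(\Upsilon;\mathbb{Z})=\tilde H_{d-1}(\Sigma;\mathbb{Z})$ (via the map induced by inclusion). Then $\{\psi(\operatorname{circ}(\Upsilon,\sigma)):\sigma\in\Sigma_d\setminus\Upsilon\}$ is an integral basis of the flow lattice $\mathcal{F}(\Sigma)=\ker_{\mathbb{Z}}\partial_d$.
   Context: $\Sigma$ has the convention of a unique $(-1)$-cell (reduced homology); $d$-cells are facets, oriented, identified with the standard basis of $C_d(\Sigma;\mathbb{Z})\cong\mathbb{Z}^n$; $\partial_d$ is the cellular boundary map. The cellular matroid is represented over $\mathbb{R}$ by the columns of $\partial_d$. A cellular spanning forest is a subcomplex containing the full $(d-1)$-skeleton, identified with its facet set, whose facets form a basis of the cellular matroid. For $\sigma\notin\Upsilon$, $\operatorname{circ}(\Upsilon,\sigma)$ is the unique circuit contained in $\Upsilon\cup\sigma$. For a circuit $C$, $\psi(C)$ denotes a generator of the rank-one free $\mathbb{Z}$-module of integer vectors in $\ker\partial_d$ supported on $C$ (i.e., a nonzero integer flow vector supported on $C$ whose entries have gcd $1$; determined up to sign). -}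

module Defs where

open import Data.Nat using (ℕ; zero; suc)
open import Data.Integer as ℤ using (ℤ; +_)
open import Data.Rational as ℚ using (ℚ; 0ℚ)
open import Data.Fin using (Fin; zero; suc)
open import Data.Fin.Subset using (Subset; _∈_; _∉_; _⊆_)
open import Data.Product using (Σ; ∃; _×_)
open import Relation.Binary.PropositionalEquality using (_≡_)
open import Relation.Nullary using (¬_)

Σℤ : ∀ {n} → (Fin n → ℤ) → ℤ
Σℤ {zero}  f = + 0
Σℤ {suc n} f = f zero ℤ.+ Σℤ (λ i → f (suc i))

Σℚ : ∀ {n} → (Fin n → ℚ) → ℚ
Σℚ {zero}  f = 0ℚ
Σℚ {suc n} f = f zero ℚ.+ Σℚ (λ i → f (suc i))

toℚ : ℤ → ℚ
toℚ i = i ℚ./ 1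

Mat : ℕ → ℕ → Set
Mat m n = Fin m → Fin n → ℤ

Chain : ℕ → Set
Chain n = Fin n → ℤ

apply : ∀ {m n} → Mat m n → Chain n → Chain m
apply ∂ c i = Σℤ (λ j → ∂ i j ℤ.* c j)

applyℚ : ∀ {m n} → Mat m n → (Fin n → ℚ) → Fin m → ℚ
applyℚ ∂ c i = Σℚ (λ j → toℚ (∂ i j) ℚ.* c j)

_-ᶜ_ : ∀ {n} → Chain n → Chain n → Chain n
(x -ᶜ y) i = x i ℤ.- y i

SupportedOn : ∀ {n} → Subset n → Chain n → Set
SupportedOn S c = ∀ j → j ∉ S → c j ≡ + 0

SupportedOnℚ : ∀ {n} → Subset n → (Fin n → ℚ) → Set
SupportedOnℚ S c = ∀ j → j ∉ S → c j ≡ 0ℚ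

SupportedOff : ∀ {n} → Subset n → Chain n → Set
SupportedOff S c = ∀ j → j ∈ S → c j ≡ + 0

-- The cellular matroid: represented over ℝ by the columns of ∂_d.
-- Columns are rational, so linear (in)dependence over ℝ coincides with
-- that over ℚ; we use ℚ.

Independent : ∀ {m n} → Mat m n → Subset n → Set
Independent ∂ S = ∀ (c : Fin _ → ℚ) → SupportedOnℚ S c →
  (∀ i → applyℚ ∂ c i ≡ 0ℚ) → ∀ j → c j ≡ 0ℚ

Spanning : ∀ {m n} → Mat m n → Subset n → Set
Spanning ∂ S = ∀ σ → Σ (Fin _ → ℚ) λ c → SupportedOnℚ S c ×
  (∀ i → applyℚ ∂ c i ≡ toℚ (∂ i σ))

-- basis of the cellular matroid = cellular spanning forest (facet set;
-- it contains the full (d-1)-skeleton by definition)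
IsCellularSpanningForest : ∀ {m n} → Mat m n → Subset n → Set
IsCellularSpanningForest ∂ S = Independent ∂ S × Spanning ∂ S

IsCircuit : ∀ {m n} → Mat m n → Subset n → Set
IsCircuit ∂ C = ¬ Independent ∂ C ×
  (∀ D → D ⊆ C → ¬ (C ⊆ D) → Independent ∂ D)

InKer : ∀ {m n} → Mat m n → Chain n → Set
InKer ∂ v = ∀ i → apply ∂ v i ≡ + 0

-- v is ψ(C): a generator of the rank-one ℤ-module of integer vectors in
-- ker ∂ supported on C
IsPsi : ∀ {m n} → Mat m n → Subset n → Chain n → Set
IsPsi ∂ C v = InKer ∂ v × SupportedOn C v × ¬ (∀ j → v j ≡ + 0) ×
  (∀ w → InKer ∂ w → SupportedOn C w → ∃ λ (k : ℤ) → ∀ j → w j ≡ k ℤ.* v j)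

-- a family b indexed by σ ∈ Σ_d \ Υ (b σ is irrelevant for σ ∈ Υ) is an
-- integral basis of the flow lattice ker_ℤ ∂
combo : ∀ {n} → (Fin n → Chain n) → Chain n → Chain n
combo b c j = Σℤ (λ σ → c σ ℤ.* b σ j)

IsIntegralFlowBasis : ∀ {m n} → Mat m n → Subset n → (Fin n → Chain n) → Set
IsIntegralFlowBasis ∂ Υ b =
  (∀ σ → σ ∉ Υ → InKer ∂ (b σ)) ×
  (∀ c → SupportedOff Υ c → (∀ j → combo b c j ≡ + 0) → ∀ σ → c σ ≡ + 0) ×
  (∀ w → InKer ∂ w → ∃ λ c → SupportedOff Υ c × (∀ j → combo b c j ≡ w j))

-- Homology in degree d-1.  ∂' = ∂_{d-1} : C_{d-1} → C_{d-2}.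
-- Cycles Z = ker ∂', boundaries of Σ = im ∂, boundaries of Υ = ∂(chains
-- supported on Υ) (Υ contains the full (d-1)-skeleton).

Cycle : ∀ {k m} → Mat k m → Chain m → Set
Cycle ∂' z = ∀ i → apply ∂' z i ≡ + 0

BoundaryOn : ∀ {m n} → Mat m n → Subset n → Chain m → Set
BoundaryOn ∂ S x = ∃ λ c → SupportedOn S c × (∀ i → apply ∂ c i ≡ x i)

Boundary : ∀ {m n} → Mat m n → Chain m → Set
Boundary ∂ x = ∃ λ c → ∀ i → apply ∂ c i ≡ x i

-- the map H̃_{d-1}(Υ) → H̃_{d-1}(Σ) induced by inclusion,
-- [z] ↦ [z], is a bijection (hence a group isomorphism)
InclusionInducesIso : ∀ {k m n} → Mat k m → Mat m n → Subset n → Set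
InclusionInducesIso ∂' ∂ Υ =
  (∀ z z' → Cycle ∂' z → Cycle ∂' z' → Boundary ∂ (z -ᶜ z') →
     BoundaryOn ∂ Υ (z -ᶜ z')) ×
  (∀ z → Cycle ∂' z → ∃ λ z' → Cycle ∂' z' × Boundary ∂ (z' -ᶜ z))

IsComplex : ∀ {k m n} → Mat k m → Mat m n → Set
IsComplex ∂' ∂ = ∀ i j → Σℤ (λ l → ∂' i l ℤ.* ∂ l j) ≡ + 0

-- Only the independence of Υ and the injectivity of H̃_{d-1}(Υ) → H̃_{d-1}(Σ)
-- are used; minimality of the circuits is not.  For σ ∉ Υ the boundary ∂σ is a
-- cycle that bounds in Σ, hence bounds a chain c₀ on Υ, so v = σ − c₀ is an
-- integer flow on Υ ∪ {σ} with v σ = 1.  Two flows on Υ ∪ {σ} are proportional,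
-- since a suitable combination of them is a flow on the independent set Υ; so
-- ψ = (ψ σ) v, and as ψ generates the flows on its circuit, v is an integer
-- multiple of ψ as well, whence ψ σ = ±1.  Outside Υ the family ψ is thus
-- diagonal with entries ±1, and a flow vanishing outside Υ vanishes, so ψ is an
-- integral basis.
module Submission where

open import Defs
open import Data.Nat using (ℕ; zero; suc)
import Data.Nat.Properties as ℕP
open import Data.Fin using (Fin; zero; suc)
open import Data.Fin.Properties using (suc-injective) renaming (_≟_ to _≟ᶠ_)
open import Data.Fin.Subset using (Subset; _∈_; _∉_; _⊆_; _∪_; ⁅_⁆)
open import Data.Fin.Subset.Properties using (_∈?_; x∈p∪q⁻; x∈p∪q⁺; x∈⁅x⁆; x∈⁅y⁆⇒x≡y)
open import Data.Integer using (ℤ; +0; +[1+_]; -[1+_]; 0ℤ; 1ℤ; -1ℤ; _+_; _*_; _-_; -_; ∣_∣)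
import Data.Integer.Properties as ℤP
open import Data.Rational as ℚ using (ℚ; 0ℚ; mkℚ)
import Data.Rational.Properties as ℚP
open import Data.Nat.Coprimality using (1-coprimeTo) renaming (sym to coprime-sym)
open import Data.Product using (_×_; _,_; proj₁; proj₂; ∃)
open import Data.Sum using (inj₁; inj₂)
open import Function using (_∘_)
open import Relation.Nullary using (yes; no)
open import Relation.Nullary.Negation using (contradiction)
open import Relation.Binary.PropositionalEquality
  using (_≡_; _≢_; _≗_; refl; sym; trans; cong; cong₂; module ≡-Reasoning)
open import Algebra.Properties.Semiring.Sum ℤP.+-*-semiring
  using (sum; sum-cong-≗; ∑-distrib-+; ∑-comm; *-distribˡ-sum)
open import Algebra.Properties.CommutativeSemigroup ℤP.*-commutativeSemigroup
  using (x∙yz≈y∙xz)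

open ≡-Reasoning

Σℤ≡sum : ∀ {n} (f : Fin n → ℤ) → Σℤ f ≡ sum f
Σℤ≡sum {zero}  f = refl
Σℤ≡sum {suc n} f = cong (f zero +_) (Σℤ≡sum (f ∘ suc))

Σℤ-cong : ∀ {n} {f g : Fin n → ℤ} → f ≗ g → Σℤ f ≡ Σℤ g
Σℤ-cong {f = f} {g} f≗g = begin
  Σℤ f   ≡⟨ Σℤ≡sum f ⟩
  sum f  ≡⟨ sum-cong-≗ f≗g ⟩
  sum g  ≡⟨ Σℤ≡sum g ⟨
  Σℤ g   ∎

Σℤ-zero : ∀ {n} {f : Fin n → ℤ} → (∀ i → f i ≡ 0ℤ) → Σℤ f ≡ 0ℤ
Σℤ-zero {zero}  f≡0 = refl
Σℤ-zero {suc n} f≡0 = cong₂ _+_ (f≡0 zero) (Σℤ-zero (f≡0 ∘ suc))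

*-distribˡ-Σℤ : ∀ {n} a (f : Fin n → ℤ) → a * Σℤ f ≡ Σℤ (λ i → a * f i)
*-distribˡ-Σℤ a f = begin
  a * Σℤ f                ≡⟨ cong (a *_) (Σℤ≡sum f) ⟩
  a * sum f               ≡⟨ *-distribˡ-sum a f ⟩
  sum (λ i → a * f i)     ≡⟨ Σℤ≡sum (λ i → a * f i) ⟨
  Σℤ (λ i → a * f i)      ∎

Σℤ-neg : ∀ {n} (f : Fin n → ℤ) → Σℤ (λ i → - f i) ≡ - Σℤ f
Σℤ-neg f = begin
  Σℤ (λ i → - f i)        ≡⟨ Σℤ-cong (λ i → ℤP.-1*i≡-i (f i)) ⟨
  Σℤ (λ i → -1ℤ * f i)    ≡⟨ *-distribˡ-Σℤ -1ℤ f ⟨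
  -1ℤ * Σℤ f              ≡⟨ ℤP.-1*i≡-i (Σℤ f) ⟩
  - Σℤ f                  ∎

Σℤ-distrib-− : ∀ {n} (f g : Fin n → ℤ) → Σℤ (λ i → f i - g i) ≡ Σℤ f - Σℤ g
Σℤ-distrib-− f g = begin
  Σℤ (λ i → f i - g i)      ≡⟨ Σℤ≡sum (λ i → f i - g i) ⟩
  sum (λ i → f i - g i)     ≡⟨ ∑-distrib-+ f (-_ ∘ g) ⟩
  sum f + sum (-_ ∘ g)      ≡⟨ cong₂ _+_ (Σℤ≡sum f) (Σℤ≡sum (-_ ∘ g)) ⟨
  Σℤ f + Σℤ (-_ ∘ g)        ≡⟨ cong (Σℤ f +_) (Σℤ-neg g) ⟩
  Σℤ f - Σℤ g               ∎

Σℤ-comm : ∀ {m n} (f : Fin m → Fin n → ℤ) →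
  Σℤ (λ i → Σℤ (f i)) ≡ Σℤ (λ j → Σℤ (λ i → f i j))
Σℤ-comm f = begin
  Σℤ (λ i → Σℤ (f i))              ≡⟨ Σℤ-cong (λ i → Σℤ≡sum (f i)) ⟩
  Σℤ (λ i → sum (f i))             ≡⟨ Σℤ≡sum (λ i → sum (f i)) ⟩
  sum (λ i → sum (f i))            ≡⟨ ∑-comm f ⟩
  sum (λ j → sum (λ i → f i j))    ≡⟨ Σℤ≡sum (λ j → sum (λ i → f i j)) ⟨
  Σℤ (λ j → sum (λ i → f i j))     ≡⟨ Σℤ-cong (λ j → Σℤ≡sum (λ i → f i j)) ⟨
  Σℤ (λ j → Σℤ (λ i → f i j))      ∎

Σℤ-single : ∀ {n} {f : Fin n → ℤ} k → (∀ i → i ≢ k → f i ≡ 0ℤ) → Σℤ f ≡ f k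
Σℤ-single {suc n} {f} zero f≡0 = begin
  f zero + Σℤ (f ∘ suc)  ≡⟨ cong (f zero +_) (Σℤ-zero (λ i → f≡0 (suc i) λ ())) ⟩
  f zero + 0ℤ            ≡⟨ ℤP.+-identityʳ (f zero) ⟩
  f zero                 ∎
Σℤ-single {suc n} {f} (suc k) f≡0 = begin
  f zero + Σℤ (f ∘ suc)  ≡⟨ cong₂ _+_ (f≡0 zero λ ()) (Σℤ-single k f∘suc≡0) ⟩
  0ℤ + f (suc k)         ≡⟨ ℤP.+-identityˡ (f (suc k)) ⟩
  f (suc k)              ∎
  where
  f∘suc≡0 : ∀ i → i ≢ k → f (suc i) ≡ 0ℤ
  f∘suc≡0 i i≢k = f≡0 (suc i) (i≢k ∘ suc-injective)

_·ᶜ_ : ∀ {n} → ℤ → Chain n → Chain n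
(a ·ᶜ x) j = a * x j

cell : ∀ {n} → Fin n → Chain n
cell σ j with j ≟ᶠ σ
... | yes _ = 1ℤ
... | no _  = 0ℤ

cell-self : ∀ {n} (σ : Fin n) → cell σ σ ≡ 1ℤ
cell-self σ with σ ≟ᶠ σ
... | yes _   = refl
... | no σ≢σ  = contradiction refl σ≢σ

cell-other : ∀ {n} {σ j : Fin n} → j ≢ σ → cell σ j ≡ 0ℤ
cell-other {σ = σ} {j} j≢σ with j ≟ᶠ σ
... | yes j≡σ = contradiction j≡σ j≢σ
... | no _    = refl

module _ {m n} (∂ : Mat m n) where

  apply-−ᶜ : ∀ x y i → apply ∂ (x -ᶜ y) i ≡ apply ∂ x i - apply ∂ y i
  apply-−ᶜ x y i =
    trans (Σℤ-cong distrib) (Σℤ-distrib-− (λ j → ∂ i j * x j) (λ j → ∂ i j * y j))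
    where
    distrib : ∀ j → ∂ i j * (x j - y j) ≡ ∂ i j * x j - ∂ i j * y j
    distrib j = trans (ℤP.*-distribˡ-+ (∂ i j) (x j) (- y j))
                      (cong (∂ i j * x j +_) (sym (ℤP.neg-distribʳ-* (∂ i j) (y j))))

  apply-·ᶜ : ∀ a x i → apply ∂ (a ·ᶜ x) i ≡ a * apply ∂ x i
  apply-·ᶜ a x i = trans (Σℤ-cong (λ j → x∙yz≈y∙xz (∂ i j) a (x j)))
                         (sym (*-distribˡ-Σℤ a (λ j → ∂ i j * x j)))

  apply-cell : ∀ σ i → apply ∂ (cell σ) i ≡ ∂ i σ
  apply-cell σ i = begin
    apply ∂ (cell σ) i     ≡⟨ Σℤ-single σ off-σ≡0 ⟩
    ∂ i σ * cell σ σ       ≡⟨ cong (∂ i σ *_) (cell-self σ) ⟩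
    ∂ i σ * 1ℤ             ≡⟨ ℤP.*-identityʳ (∂ i σ) ⟩
    ∂ i σ                  ∎
    where
    off-σ≡0 : ∀ j → j ≢ σ → ∂ i j * cell σ j ≡ 0ℤ
    off-σ≡0 j j≢σ = trans (cong (∂ i j *_) (cell-other j≢σ)) (ℤP.*-zeroʳ (∂ i j))

  apply-combo : ∀ b c i → apply ∂ (combo b c) i ≡ Σℤ (λ σ → c σ * apply ∂ (b σ) i)
  apply-combo b c i = begin
    Σℤ (λ j → ∂ i j * Σℤ (λ σ → c σ * b σ j))
      ≡⟨ Σℤ-cong (λ j → *-distribˡ-Σℤ (∂ i j) (λ σ → c σ * b σ j)) ⟩
    Σℤ (λ j → Σℤ (λ σ → ∂ i j * (c σ * b σ j)))
      ≡⟨ Σℤ-comm (λ j σ → ∂ i j * (c σ * b σ j)) ⟩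
    Σℤ (λ σ → Σℤ (λ j → ∂ i j * (c σ * b σ j)))
      ≡⟨ Σℤ-cong (λ σ → apply-·ᶜ (c σ) (b σ) i) ⟩
    Σℤ (λ σ → c σ * apply ∂ (b σ) i)
      ∎

  InKer-−ᶜ : ∀ {x y} → InKer ∂ x → InKer ∂ y → InKer ∂ (x -ᶜ y)
  InKer-−ᶜ {x} {y} ∂x≡0 ∂y≡0 i = begin
    apply ∂ (x -ᶜ y) i          ≡⟨ apply-−ᶜ x y i ⟩
    apply ∂ x i - apply ∂ y i   ≡⟨ cong₂ _-_ (∂x≡0 i) (∂y≡0 i) ⟩
    0ℤ                          ∎

  InKer-·ᶜ : ∀ a {x} → InKer ∂ x → InKer ∂ (a ·ᶜ x)
  InKer-·ᶜ a {x} ∂x≡0 i = begin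
    apply ∂ (a ·ᶜ x) i   ≡⟨ apply-·ᶜ a x i ⟩
    a * apply ∂ x i      ≡⟨ cong (a *_) (∂x≡0 i) ⟩
    a * 0ℤ               ≡⟨ ℤP.*-zeroʳ a ⟩
    0ℤ                   ∎

private
  embed : ℤ → ℚ
  embed i = mkℚ i 0 (coprime-sym (1-coprimeTo _))

  -- i / 1 normalises to this literal, on which ℚ's + and * compute.
  toℚ≡embed : ∀ i → toℚ i ≡ embed i
  toℚ≡embed i = ℚP.↥p/↧p≡p (embed i)

toℚ-+ : ∀ a b → toℚ (a + b) ≡ toℚ a ℚ.+ toℚ b
toℚ-+ a b rewrite toℚ≡embed a | toℚ≡embed b =
  cong (ℚ._/ 1) (sym (cong₂ _+_ (ℤP.*-identityʳ a) (ℤP.*-identityʳ b)))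

toℚ-* : ∀ a b → toℚ (a * b) ≡ toℚ a ℚ.* toℚ b
toℚ-* a b rewrite toℚ≡embed a | toℚ≡embed b = refl

toℚ≡0⇒≡0 : ∀ a → toℚ a ≡ 0ℚ → a ≡ 0ℤ
toℚ≡0⇒≡0 a a≡0 = cong ℚ.↥_ (trans (sym (toℚ≡embed a)) (trans a≡0 (toℚ≡embed 0ℤ)))

Σℚ-cong : ∀ {n} {f g : Fin n → ℚ} → f ≗ g → Σℚ f ≡ Σℚ g
Σℚ-cong {zero}  f≗g = refl
Σℚ-cong {suc n} f≗g = cong₂ ℚ._+_ (f≗g zero) (Σℚ-cong (f≗g ∘ suc))

toℚ-Σℤ : ∀ {n} (f : Fin n → ℤ) → toℚ (Σℤ f) ≡ Σℚ (toℚ ∘ f)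
toℚ-Σℤ {zero}  f = refl
toℚ-Σℤ {suc n} f =
  trans (toℚ-+ (f zero) (Σℤ (f ∘ suc))) (cong (toℚ (f zero) ℚ.+_) (toℚ-Σℤ (f ∘ suc)))

applyℚ-toℚ : ∀ {m n} (∂ : Mat m n) x i → applyℚ ∂ (toℚ ∘ x) i ≡ toℚ (apply ∂ x i)
applyℚ-toℚ ∂ x i =
  trans (Σℚ-cong (λ j → sym (toℚ-* (∂ i j) (x j)))) (sym (toℚ-Σℤ (λ j → ∂ i j * x j)))

Independent⇒flow≡0 : ∀ {m n} (∂ : Mat m n) {S x} → Independent ∂ S →
  InKer ∂ x → SupportedOn S x → ∀ j → x j ≡ 0ℤ
Independent⇒flow≡0 ∂ {x = x} indep ∂x≡0 x-on-S j = toℚ≡0⇒≡0 (x j)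
  (indep (toℚ ∘ x) (λ j j∉S → cong toℚ (x-on-S j j∉S))
         (λ i → trans (applyℚ-toℚ ∂ x i) (cong toℚ (∂x≡0 i))) j)

SupportedOn-mono : ∀ {n} {S T : Subset n} {x} → S ⊆ T → SupportedOn S x → SupportedOn T x
SupportedOn-mono S⊆T x-on-S j j∉T = x-on-S j (j∉T ∘ S⊆T)

∉∪⁅⁆ : ∀ {n} {S : Subset n} {σ j} → j ∉ S → j ≢ σ → j ∉ S ∪ ⁅ σ ⁆
∉∪⁅⁆ {S = S} {σ} j∉S j≢σ j∈ with x∈p∪q⁻ S ⁅ σ ⁆ j∈
... | inj₁ j∈S  = j∉S j∈S
... | inj₂ j∈σ  = j≢σ (x∈⁅y⁆⇒x≡y σ j∈σ)

∈∪⁅⁆ : ∀ {n} (S : Subset n) σ → σ ∈ S ∪ ⁅ σ ⁆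
∈∪⁅⁆ S σ = x∈p∪q⁺ (inj₂ (x∈⁅x⁆ σ))

HasFlowWithUnitEntry : ∀ {m n} → Mat m n → Subset n → Fin n → Set
HasFlowWithUnitEntry ∂ Υ σ = ∃ λ v → InKer ∂ v × SupportedOn (Υ ∪ ⁅ σ ⁆) v × v σ ≡ 1ℤ

module _ {k m n} (∂' : Mat k m) (∂ : Mat m n) {Υ : Subset n} where

  hasFlowWithUnitEntry : IsComplex ∂' ∂ → InclusionInducesIso ∂' ∂ Υ →
    ∀ {σ} → σ ∉ Υ → HasFlowWithUnitEntry ∂ Υ σ
  hasFlowWithUnitEntry ∂'∂≡0 (injective , _) {σ} σ∉Υ = v , ∂v≡0 , v-support , v-σ
    where
    zero-cycle : Cycle ∂' (λ _ → 0ℤ)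
    zero-cycle i = Σℤ-zero (λ l → ℤP.*-zeroʳ (∂' i l))

    bounds-on-Υ : BoundaryOn ∂ Υ (λ i → ∂ i σ - 0ℤ)
    bounds-on-Υ = injective (λ i → ∂ i σ) (λ _ → 0ℤ) (λ i → ∂'∂≡0 i σ) zero-cycle
      (cell σ , λ i → trans (apply-cell ∂ σ i) (sym (ℤP.+-identityʳ (∂ i σ))))

    c₀ : Chain n
    c₀ = proj₁ bounds-on-Υ

    c₀-on-Υ : SupportedOn Υ c₀
    c₀-on-Υ = proj₁ (proj₂ bounds-on-Υ)

    ∂c₀ : ∀ i → apply ∂ c₀ i ≡ ∂ i σ - 0ℤ
    ∂c₀ = proj₂ (proj₂ bounds-on-Υ)

    v : Chain n
    v = cell σ -ᶜ c₀

    ∂v≡0 : InKer ∂ v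
    ∂v≡0 i = begin
      apply ∂ v i                            ≡⟨ apply-−ᶜ ∂ (cell σ) c₀ i ⟩
      apply ∂ (cell σ) i - apply ∂ c₀ i      ≡⟨ cong₂ _-_ (apply-cell ∂ σ i) (∂c₀ i) ⟩
      ∂ i σ - (∂ i σ - 0ℤ)                   ≡⟨ cong (λ t → ∂ i σ - t) (ℤP.+-identityʳ (∂ i σ)) ⟩
      ∂ i σ - ∂ i σ                          ≡⟨ ℤP.+-inverseʳ (∂ i σ) ⟩
      0ℤ                                     ∎

    v-support : SupportedOn (Υ ∪ ⁅ σ ⁆) v
    v-support j j∉ =
      cong₂ _-_ (cell-other (λ j≡σ → j∉ (∈σ j≡σ))) (c₀-on-Υ j (j∉ ∘ x∈p∪q⁺ ∘ inj₁))
      where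
      ∈σ : j ≡ σ → j ∈ Υ ∪ ⁅ σ ⁆
      ∈σ refl = ∈∪⁅⁆ Υ σ

    v-σ : v σ ≡ 1ℤ
    v-σ = cong₂ _-_ (cell-self σ) (c₀-on-Υ σ σ∉Υ)

module _ {m n} (∂ : Mat m n) {Υ : Subset n} (indep : Independent ∂ Υ) where

  flow-vanishes-at : ∀ {σ x} → InKer ∂ x → SupportedOn (Υ ∪ ⁅ σ ⁆) x →
    x σ ≡ 0ℤ → ∀ j → x j ≡ 0ℤ
  flow-vanishes-at {σ} {x} ∂x≡0 x-support xσ≡0 = Independent⇒flow≡0 ∂ indep ∂x≡0 x-on-Υ
    where
    x-on-Υ : SupportedOn Υ x
    x-on-Υ j j∉Υ with j ≟ᶠ σ
    ... | yes refl = xσ≡0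
    ... | no j≢σ   = x-support j (∉∪⁅⁆ j∉Υ j≢σ)

  flows-proportional : ∀ {σ x y} → InKer ∂ x → InKer ∂ y →
    SupportedOn (Υ ∪ ⁅ σ ⁆) x → SupportedOn (Υ ∪ ⁅ σ ⁆) y →
    ∀ j → y σ * x j ≡ x σ * y j
  flows-proportional {σ} {x} {y} ∂x≡0 ∂y≡0 x-support y-support j =
    ℤP.i-j≡0⇒i≡j _ _ (flow-vanishes-at ∂z≡0 z-support zσ≡0 j)
    where
    z : Chain n
    z = (y σ ·ᶜ x) -ᶜ (x σ ·ᶜ y)

    ∂z≡0 : InKer ∂ z
    ∂z≡0 = InKer-−ᶜ ∂ (InKer-·ᶜ ∂ (y σ) ∂x≡0) (InKer-·ᶜ ∂ (x σ) ∂y≡0)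

    z-support : SupportedOn (Υ ∪ ⁅ σ ⁆) z
    z-support τ τ∉ = begin
      y σ * x τ - x σ * y τ    ≡⟨ cong₂ (λ s t → y σ * s - x σ * t) (x-support τ τ∉) (y-support τ τ∉) ⟩
      y σ * 0ℤ - x σ * 0ℤ      ≡⟨ cong₂ _-_ (ℤP.*-zeroʳ (y σ)) (ℤP.*-zeroʳ (x σ)) ⟩
      0ℤ                       ∎

    zσ≡0 : z σ ≡ 0ℤ
    zσ≡0 = trans (cong (_- x σ * y σ) (ℤP.*-comm (y σ) (x σ))) (ℤP.+-inverseʳ (x σ * y σ))

  IsPsi⇒∣diagonal∣≡1 : ∀ {σ C ψ} → IsPsi ∂ C ψ → C ⊆ Υ ∪ ⁅ σ ⁆ →
    HasFlowWithUnitEntry ∂ Υ σ → ∣ ψ σ ∣ ≡ 1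
  IsPsi⇒∣diagonal∣≡1 {σ} {C} {ψ} (∂ψ≡0 , ψ-on-C , ψ≢0 , generates) C⊆
    (v , ∂v≡0 , v-support , vσ≡1) =
    ℕP.m*n≡1⇒n≡1 ∣ a ∣ ∣ ψ σ ∣ (trans (sym (ℤP.abs-* a (ψ σ))) (cong ∣_∣ aψσ≡1))
    where
    ψ-support : SupportedOn (Υ ∪ ⁅ σ ⁆) ψ
    ψ-support = SupportedOn-mono C⊆ ψ-on-C

    ψσ≢0 : ψ σ ≢ 0ℤ
    ψσ≢0 ψσ≡0 = ψ≢0 (flow-vanishes-at ∂ψ≡0 ψ-support ψσ≡0)

    ψσv≡ψ : ∀ j → ψ σ * v j ≡ ψ j
    ψσv≡ψ j = trans (flows-proportional ∂v≡0 ∂ψ≡0 v-support ψ-support j)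
                    (trans (cong (_* ψ j) vσ≡1) (ℤP.*-identityˡ (ψ j)))

    v-on-C : SupportedOn C v
    v-on-C j j∉C with ℤP.i*j≡0⇒i≡0∨j≡0 (ψ σ) (trans (ψσv≡ψ j) (ψ-on-C j j∉C))
    ... | inj₁ ψσ≡0 = contradiction ψσ≡0 ψσ≢0
    ... | inj₂ vj≡0 = vj≡0

    v=aψ : ∃ λ a → ∀ j → v j ≡ a * ψ j
    v=aψ = generates v ∂v≡0 v-on-C

    a : ℤ
    a = proj₁ v=aψ

    aψσ≡1 : a * ψ σ ≡ 1ℤ
    aψσ≡1 = trans (sym (proj₂ v=aψ σ)) vσ≡1

∣j∣≡1⇒i*j*j≡i : ∀ i j → ∣ j ∣ ≡ 1 → i * j * j ≡ i
∣j∣≡1⇒i*j*j≡i i j ∣j∣≡1 = begin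
  i * j * j    ≡⟨ ℤP.*-assoc i j j ⟩
  i * (j * j)  ≡⟨ cong (i *_) (j*j≡1 j ∣j∣≡1) ⟩
  i * 1ℤ       ≡⟨ ℤP.*-identityʳ i ⟩
  i            ∎
  where
  j*j≡1 : ∀ j → ∣ j ∣ ≡ 1 → j * j ≡ 1ℤ
  j*j≡1 +0             ()
  j*j≡1 +[1+ 0 ]       _ = refl
  j*j≡1 +[1+ suc n ]   ()
  j*j≡1 -[1+ 0 ]       _ = refl
  j*j≡1 -[1+ suc n ]   ()

restrictOutside : ∀ {n} → Subset n → Chain n → Chain n
restrictOutside Υ x σ with σ ∈? Υ
... | yes _ = 0ℤ
... | no _  = x σ

restrictOutside-off : ∀ {n} (Υ : Subset n) x → SupportedOff Υ (restrictOutside Υ x)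
restrictOutside-off Υ x σ σ∈Υ with σ ∈? Υ
... | yes _    = refl
... | no σ∉Υ   = contradiction σ∈Υ σ∉Υ

restrictOutside-∉ : ∀ {n} {Υ : Subset n} {σ} x → σ ∉ Υ → restrictOutside Υ x σ ≡ x σ
restrictOutside-∉ {Υ = Υ} {σ} x σ∉Υ with σ ∈? Υ
... | yes σ∈Υ = contradiction σ∈Υ σ∉Υ
... | no _    = refl

module _ {m n} (∂ : Mat m n) {Υ : Subset n} (indep : Independent ∂ Υ)
  {b : Fin n → Chain n}
  (b-flow : ∀ σ → σ ∉ Υ → InKer ∂ (b σ))
  (b-support : ∀ σ → σ ∉ Υ → SupportedOn (Υ ∪ ⁅ σ ⁆) (b σ))
  (b-diagonal : ∀ σ → σ ∉ Υ → ∣ b σ σ ∣ ≡ 1) where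

  combo-outside : ∀ {c} → SupportedOff Υ c → ∀ τ → τ ∉ Υ → combo b c τ ≡ c τ * b τ τ
  combo-outside {c} c-off τ τ∉Υ = Σℤ-single τ term≡0
    where
    term≡0 : ∀ σ → σ ≢ τ → c σ * b σ τ ≡ 0ℤ
    term≡0 σ σ≢τ with σ ∈? Υ
    ... | yes σ∈Υ = cong (_* b σ τ) (c-off σ σ∈Υ)
    ... | no σ∉Υ  = trans (cong (c σ *_) (b-support σ σ∉Υ τ (∉∪⁅⁆ τ∉Υ (σ≢τ ∘ sym))))
                          (ℤP.*-zeroʳ (c σ))

  combo-flow : ∀ {c} → SupportedOff Υ c → InKer ∂ (combo b c)
  combo-flow {c} c-off i = trans (apply-combo ∂ b c i) (Σℤ-zero term≡0)
    where
    term≡0 : ∀ σ → c σ * apply ∂ (b σ) i ≡ 0ℤ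
    term≡0 σ with σ ∈? Υ
    ... | yes σ∈Υ = cong (_* apply ∂ (b σ) i) (c-off σ σ∈Υ)
    ... | no σ∉Υ  = trans (cong (c σ *_) (b-flow σ σ∉Υ i)) (ℤP.*-zeroʳ (c σ))

  combo-injective : ∀ c → SupportedOff Υ c → (∀ j → combo b c j ≡ 0ℤ) → ∀ σ → c σ ≡ 0ℤ
  combo-injective c c-off combo≡0 σ with σ ∈? Υ
  ... | yes σ∈Υ = c-off σ σ∈Υ
  ... | no σ∉Υ  = begin
    c σ                    ≡⟨ ∣j∣≡1⇒i*j*j≡i (c σ) (b σ σ) (b-diagonal σ σ∉Υ) ⟨
    c σ * b σ σ * b σ σ    ≡⟨ cong (_* b σ σ) (combo-outside c-off σ σ∉Υ) ⟨
    combo b c σ * b σ σ    ≡⟨ cong (_* b σ σ) (combo≡0 σ) ⟩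
    0ℤ                     ∎

  -- On σ ∉ Υ the coefficient w σ * b σ σ reproduces w σ, because b σ σ = ±1.
  combo-surjective : ∀ w → InKer ∂ w → ∃ λ c → SupportedOff Υ c × (∀ j → combo b c j ≡ w j)
  combo-surjective w ∂w≡0 = c , c-off , combo≡w
    where
    c : Chain n
    c = restrictOutside Υ (λ σ → w σ * b σ σ)

    c-off : SupportedOff Υ c
    c-off = restrictOutside-off Υ _

    rest-on-Υ : SupportedOn Υ (w -ᶜ combo b c)
    rest-on-Υ τ τ∉Υ = begin
      w τ - combo b c τ          ≡⟨ cong (λ t → w τ - t) (combo-outside c-off τ τ∉Υ) ⟩
      w τ - c τ * b τ τ          ≡⟨ cong (λ t → w τ - t * b τ τ) (restrictOutside-∉ _ τ∉Υ) ⟩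
      w τ - w τ * b τ τ * b τ τ  ≡⟨ cong (λ t → w τ - t) (∣j∣≡1⇒i*j*j≡i (w τ) (b τ τ) (b-diagonal τ τ∉Υ)) ⟩
      w τ - w τ                  ≡⟨ ℤP.+-inverseʳ (w τ) ⟩
      0ℤ                         ∎

    combo≡w : ∀ j → combo b c j ≡ w j
    combo≡w j = sym (ℤP.i-j≡0⇒i≡j _ _
      (Independent⇒flow≡0 ∂ indep (InKer-−ᶜ ∂ ∂w≡0 (combo-flow c-off)) rest-on-Υ j))

  diagonal-unit⇒IsIntegralFlowBasis : IsIntegralFlowBasis ∂ Υ b
  diagonal-unit⇒IsIntegralFlowBasis = b-flow , combo-injective , combo-surjective

theorem6p2 : (k m n : ℕ) (∂' : Mat k m) (∂ : Mat m n) → IsComplex ∂' ∂ →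
    (Υ : Subset n) → IsCellularSpanningForest ∂ Υ →
    InclusionInducesIso ∂' ∂ Υ →
    (C : Fin n → Subset n) (ψ : Fin n → Chain n) →
    (∀ σ → σ ∉ Υ → IsCircuit ∂ (C σ) × C σ ⊆ Υ ∪ ⁅ σ ⁆ × IsPsi ∂ (C σ) (ψ σ)) →
    IsIntegralFlowBasis ∂ Υ ψ
theorem6p2 k m n ∂' ∂ ∂'∂≡0 Υ (indep , _) iso C ψ fundamental =
  diagonal-unit⇒IsIntegralFlowBasis ∂ indep ψ-flow ψ-support ψ-diagonal
  where
  ψ-flow : ∀ σ → σ ∉ Υ → InKer ∂ (ψ σ)
  ψ-flow σ σ∉Υ with fundamental σ σ∉Υ
  ... | _ , _ , ∂ψ≡0 , _ = ∂ψ≡0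

  ψ-support : ∀ σ → σ ∉ Υ → SupportedOn (Υ ∪ ⁅ σ ⁆) (ψ σ)
  ψ-support σ σ∉Υ with fundamental σ σ∉Υ
  ... | _ , C⊆ , _ , ψ-on-C , _ = SupportedOn-mono C⊆ ψ-on-C

  ψ-diagonal : ∀ σ → σ ∉ Υ → ∣ ψ σ σ ∣ ≡ 1
  ψ-diagonal σ σ∉Υ with fundamental σ σ∉Υ
  ... | _ , C⊆ , isPsi = IsPsi⇒∣diagonal∣≡1 ∂ indep isPsi C⊆ (hasFlowWithUnitEntry ∂' ∂ ∂'∂≡0 iso σ∉Υ)
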